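{- Let $\Omega$ be a $D$-set, possibly augmented with unary predicates. If two unbounded indiscernible sequences $s_1,s_2$ in $\Omega$ are mutually indiscernible, then $H(s_1)\cap H(s_2)=\emptyset$.
   Context: A $D$-set is a set $\Omega$ with a quaternary relation $D$, written $D(wx;yz)$ or $wx|yz$, satisfying for all $w,x,y,z$: (D1) $D(wx;yz)\to (D(xw;yz)\wedge D(yz;wx))$; (D2) $D(wx;yz)\to\neg D(wy;xz)$; (D3) $D(wx;yz)\to\forall v\,(D(vx;yz)\vee D(wx;yv))$; (D4) $(w\neq y\wedge x\neq y)\to D(wx;yy)$. A splitting of $\Omega$ is a partition into at least two parts (sectors) such that (i) if $a,b$ lie in a part $\Sigma$ and $c,d\notin\Sigma$ then $D(ab;cd)$, (ii) if $a,b,c,d$ lie in four distinct parts then $\neg D(ab;cd)$; a node splitting has more than two sectors. Every splitting of a subset $A$ with more than two parts extends uniquely to a node splitting of $\Omega$ whose sectors meet $A$ in the parts. Sequences (of tuples) are indexed by a linear order with no least or greatest element (unbounded); indiscernible means order-indiscernible over $\emptyset$; two sequences are mutually indiscernible if each is indiscernible over the set of elements appearing in the other. An indiscernible sequence $t=(a_i)$ of single elements is constant, or petaled (pairwise distinct and no $D(a_ia_j;a_ka_\ell)$ with $i,j,k,\ell$ pairwise distinct), or monotonic (pairwise distinct and $a_ia_j|a_ka_\ell$ for $i<j<k<\ell$). Its discernible hull $H(t)$ is: $\emptyset$ if constant; if petaled, the union of the sectors containing elements of $t$ of the node splitting of $\Omega$ extending $\{\{a_i\}\}$; if monotonic, $t\cup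 H_1(t)\cup H_2(t)\cup H_3(t)$ with $H_1(t)=\{x:\exists i<j<k,\ a_ia_k|a_jx\}$, $H_2(t)=\{x:\exists i<j<k$ with no $D$-relation among distinct elements of $\{a_i,a_j,a_k,x\}\}$, $H_3(t)=\{x:\exists i<j<k<\ell,\ a_ix|a_ka_\ell\wedge a_ia_j|xa_\ell\}$. The hull of a sequence of tuples is the union of the hulls of its coordinate sequences. -}

module Defs where

open import Data.Nat using (ℕ; suc)
open import Data.Fin using (Fin) renaming (_<_ to _<ᶠ_)
open import Data.Product using (Σ; ∃; _×_; _,_)
open import Data.Sum using (_⊎_; inj₁; inj₂)
open import Data.Empty using (⊥)
open import Data.Unit using (⊤)
open import Relation.Nullary using (¬_)
open import Relation.Binary.PropositionalEquality using (_≡_; _≢_)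
open import Relation.Binary.Core using (Rel)
open import Relation.Binary.Structures using (IsStrictTotalOrder; IsEquivalence)
open import Function.Bundles using (_⇔_)
open import Level using (0ℓ; Lift)
import Level

-- D-sets, possibly augmented with a family of unary predicates
-- (indexed by an arbitrary type P; P = ⊥ gives a plain D-set).

record DSet : Set₁ where
  field
    Ω  : Set
    D  : Ω → Ω → Ω → Ω → Set          -- D w x y z  means  wx | yz
    D1 : ∀ {w x y z} → D w x y z → D x w y z × D y z w x
    D2 : ∀ {w x y z} → D w x y z → ¬ D w y x z
    D3 : ∀ {w x y z} → D w x y z → ∀ v → D v x y z ⊎ D w x y v
    D4 : ∀ {w x y} → w ≢ y → x ≢ y → D w x y y
    P  : Set
    U  : P → Ω → Set

record UnboundedLinearOrder : Set₁ where
  field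
    I       : Set
    _<_     : Rel I _
    isSTO   : IsStrictTotalOrder _≡_ _<_
    noLeast    : ∀ i → ∃ λ j → j < i
    noGreatest : ∀ i → ∃ λ j → i < j

-- First-order formulas of the language {=, D} ∪ {U p | p : P},
-- with free variables Fin k (de Bruijn style).

data Formula (P : Set) : ℕ → Set where
  eqF  : ∀ {k} → Fin k → Fin k → Formula P k
  DF   : ∀ {k} → Fin k → Fin k → Fin k → Fin k → Formula P k
  UF   : ∀ {k} → P → Fin k → Formula P k
  negF : ∀ {k} → Formula P k → Formula P k
  andF : ∀ {k} → Formula P k → Formula P k → Formula P k
  exF  : ∀ {k} → Formula P (suc k) → Formula P k

module _ (M : DSet) where
  open DSet M

  extend : ∀ {k} → Ω → (Fin k → Ω) → Fin (suc k) → Ω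
  extend a ρ Fin.zero    = a
  extend a ρ (Fin.suc v) = ρ v

  Sat : ∀ {k} → Formula P k → (Fin k → Ω) → Set
  Sat (eqF x y)     ρ = ρ x ≡ ρ y
  Sat (DF w x y z)  ρ = D (ρ w) (ρ x) (ρ y) (ρ z)
  Sat (UF p x)      ρ = U p (ρ x)
  Sat (negF φ)      ρ = ¬ Sat φ ρ
  Sat (andF φ ψ)    ρ = Sat φ ρ × Sat ψ ρ
  Sat (exF φ)       ρ = Σ Ω λ a → Sat φ (extend a ρ)

  module _ (L : UnboundedLinearOrder) where
    open UnboundedLinearOrder L

    Increasing : ∀ {n} → (Fin n → I) → Set
    Increasing {n} f = ∀ (p q : Fin n) → p <ᶠ q → f p < f q

    TupleSeq : ℕ → Set
    TupleSeq m = I → Fin m → Ω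

    -- A formula with k free variables is instantiated by an assignment
    -- ρ sending each variable either to coordinate c of the p-th element
    -- of an increasing n-tuple of indices, or to a parameter from A.
    instantiate : ∀ {m n k} (A : Ω → Set) → TupleSeq m → (Fin n → I) →
                  (Fin k → (Fin n × Fin m) ⊎ Σ Ω A) → Fin k → Ω
    instantiate A s f ρ v with ρ v
    ... | inj₁ (p , c) = s (f p) c
    ... | inj₂ (a , _) = a

    IndiscernibleOver : ∀ {m} → (Ω → Set) → TupleSeq m → Set
    IndiscernibleOver {m} A s =
      ∀ {n k} (φ : Formula P k) (ρ : Fin k → (Fin n × Fin m) ⊎ Σ Ω A)
        (f g : Fin n → I) → Increasing f → Increasing g →
        Sat φ (instantiate A s f ρ) ⇔ Sat φ (instantiate A s g ρ)

    Indiscernible : ∀ {m} → TupleSeq m → Set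
    Indiscernible = IndiscernibleOver (λ _ → ⊥)

    ElemsOf : ∀ {m} → TupleSeq m → Ω → Set
    ElemsOf s x = ∃ λ i → ∃ λ c → s i c ≡ x

    Seq : Set
    Seq = I → Ω

    Constant : Seq → Set
    Constant a = ∀ i j → a i ≡ a j

    PairwiseDistinct : Seq → Set
    PairwiseDistinct a = ∀ i j → i ≢ j → a i ≢ a j

    Petaled : Seq → Set
    Petaled a = PairwiseDistinct a ×
      (∀ i j k l → i ≢ j → i ≢ k → i ≢ l → j ≢ k → j ≢ l → k ≢ l →
         ¬ D (a i) (a j) (a k) (a l))

    Monotonic : Seq → Set
    Monotonic a = PairwiseDistinct a ×
      (∀ i j k l → i < j → j < k → k < l → D (a i) (a j) (a k) (a l))

    -- Splittings, presented by the equivalence relation "same sector"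

    record IsSplitting (E : Rel Ω 0ℓ) : Set where
      field
        isEquiv   : IsEquivalence E
        twoParts  : ∃ λ a → ∃ λ b → ¬ E a b
        condI     : ∀ a b c d → E a b → ¬ E a c → ¬ E a d → D a b c d
        condII    : ∀ a b c d → ¬ E a b → ¬ E a c → ¬ E a d →
                    ¬ E b c → ¬ E b d → ¬ E c d → ¬ D a b c d

    IsNodeSplitting : Rel Ω 0ℓ → Set
    IsNodeSplitting E = IsSplitting E ×
      (∃ λ a → ∃ λ b → ∃ λ c → ¬ E a b × ¬ E a c × ¬ E b c)

    -- petaled case: union of the sectors containing elements of a of the
    -- node splitting of Ω whose sectors meet {a i} in the singletons {a i}
    -- (such a node splitting exists and is unique).
    PetalHull : Seq → Ω → Set₁
    PetalHull a x = ∃ λ (E : Rel Ω 0ℓ) → IsNodeSplitting E ×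
      (∀ i j → E (a i) (a j) → a i ≡ a j) × (∃ λ i → E x (a i))

    In4 : Ω → Ω → Ω → Ω → Ω → Set
    In4 p q r s y = y ≡ p ⊎ y ≡ q ⊎ y ≡ r ⊎ y ≡ s

    H₁ : Seq → Ω → Set
    H₁ a x = ∃ λ i → ∃ λ j → ∃ λ k → i < j × j < k × D (a i) (a k) (a j) x

    H₂ : Seq → Ω → Set
    H₂ a x = ∃ λ i → ∃ λ j → ∃ λ k → i < j × j < k ×
      (∀ w y z u → In4 (a i) (a j) (a k) x w → In4 (a i) (a j) (a k) x y →
                   In4 (a i) (a j) (a k) x z → In4 (a i) (a j) (a k) x u →
                   w ≢ y → w ≢ z → w ≢ u → y ≢ z → y ≢ u → z ≢ u →
                   ¬ D w y z u)

    H₃ : Seq → Ω → Set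
    H₃ a x = ∃ λ i → ∃ λ j → ∃ λ k → ∃ λ l → i < j × j < k × k < l ×
      D (a i) x (a k) (a l) × D (a i) (a j) x (a l)

    MonoHull : Seq → Ω → Set
    MonoHull a x = (∃ λ i → a i ≡ x) ⊎ H₁ a x ⊎ H₂ a x ⊎ H₃ a x

    -- H(t): empty if constant; PetalHull if petaled; MonoHull if monotonic
    Hull : Seq → Ω → Set₁
    Hull a x = (Lift (Level.suc 0ℓ) (Petaled a) × PetalHull a x) ⊎ Lift (Level.suc 0ℓ) (Monotonic a × MonoHull a x)

    HullT : ∀ {m} → TupleSeq m → Ω → Set₁
    HullT {m} s x = ∃ λ (c : Fin m) → Hull (λ i → s i c) x

-- Suppose x lies in the hulls of a coordinate sequence a of s₁ and b of s₂.
-- Indiscernibility of s₁ over the elements of s₂ keeps every such element out of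
-- the hull of a (and symmetrically), so x is an element of neither sequence.
-- Each b n falls on one side of the configuration formed by a, the same side for
-- every n by mutual indiscernibility, and this anchors x:  x a_t | a_r b_n  for all n,
-- hence  x a_t | b_m b_n  for all m, n.  A point that no pair of b separates from a
-- hull point of b lies itself in the hull of b, so a_t does, a contradiction.
-- Case distinctions on undecidable relations are made under double negation, which is
-- harmless since the goal is ⊥.

module Submission where

open import Data.Empty using (⊥)
open import Data.Fin using (Fin; zero; suc; #_)
open import Data.Nat using (ℕ; suc; z≤n; s≤s)
open import Data.Product using (Σ; ∃; ∃₂; _×_; _,_; proj₁; proj₂)
open import Data.Sum using (_⊎_; inj₁; inj₂; [_,_])
open import Data.Vec.Functional using (Vector; []; _∷_)
open import Function using (_∘_)
open import Function.Bundles using (Equivalence)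
open import Level using (0ℓ; lift)
open import Relation.Binary.Core using (Rel)
open import Relation.Binary.Structures using (IsStrictTotalOrder; IsEquivalence)
open import Relation.Binary.PropositionalEquality using (_≡_; _≢_; refl; sym; trans; ≢-sym)
open import Relation.Nullary using (¬_; yes; no)
open import Relation.Nullary.Negation using (contradiction; ¬¬-map)
open import Relation.Nullary.Decidable using (¬¬-excluded-middle)

open import Defs

module DSetProperties (M : DSet) where
  open DSet M

  private variable p q r s w x y z u : Ω

  D-swapˡ : D w x y z → D x w y z
  D-swapˡ = proj₁ ∘ D1

  D-swapPairs : D w x y z → D y z w x
  D-swapPairs = proj₂ ∘ D1

  D-swapʳ : D w x y z → D w x z y
  D-swapʳ = D-swapPairs ∘ D-swapˡ ∘ D-swapPairs

  D-combine : D x y r p → D x y r q → D x y p q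
  D-combine {x} {y} {r} {p} {q} d₁ d₂ with D3 (D-swapPairs d₁) q | D3 (D-swapPairs d₂) p
  ... | inj₁ qp∣xy | _          = D-swapʳ (D-swapPairs qp∣xy)
  ... | inj₂ _     | inj₁ pq∣xy = D-swapPairs pq∣xy
  ... | inj₂ rp∣xq | inj₂ rq∣xp = contradiction (D-swapʳ rq∣xp) (D2 (D-swapʳ rp∣xq))

  Unrelated : Ω → Ω → Ω → Ω → Set
  Unrelated p q r s = ¬ D p q r s × ¬ D p r q s × ¬ D p s q r

  Unrelated-swap₁₂ : Unrelated p q r s → Unrelated q p r s
  Unrelated-swap₁₂ (¬pq∣rs , ¬pr∣qs , ¬ps∣qr) =
    ¬pq∣rs ∘ D-swapˡ , ¬ps∣qr ∘ D-swapPairs , ¬pr∣qs ∘ D-swapPairs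

  Unrelated-rotate₃ : Unrelated p q r s → Unrelated r p q s
  Unrelated-rotate₃ (¬pq∣rs , ¬pr∣qs , ¬ps∣qr) =
    ¬pr∣qs ∘ D-swapˡ , ¬ps∣qr ∘ D-swapʳ ∘ D-swapPairs , ¬pq∣rs ∘ D-swapPairs

  Unrelated-rotate₄ : Unrelated p q r s → Unrelated s p q r
  Unrelated-rotate₄ (¬pq∣rs , ¬pr∣qs , ¬ps∣qr) =
    ¬ps∣qr ∘ D-swapˡ , ¬pr∣qs ∘ D-swapʳ ∘ D-swapPairs , ¬pq∣rs ∘ D-swapʳ ∘ D-swapPairs

  In2 : Ω → Ω → Ω → Set
  In2 r s y = y ≡ r ⊎ y ≡ s

  In3 : Ω → Ω → Ω → Ω → Set
  In3 q r s y = y ≡ q ⊎ In2 r s y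

  -- definitionally equal to In4 of Defs, which carries an unused order parameter
  In4′ : Ω → Ω → Ω → Ω → Ω → Set
  In4′ p q r s y = y ≡ p ⊎ In3 q r s y

  NoDAmong : Ω → Ω → Ω → Ω → Set
  NoDAmong p q r s = ∀ w y z u →
    In4′ p q r s w → In4′ p q r s y → In4′ p q r s z → In4′ p q r s u →
    w ≢ y → w ≢ z → w ≢ u → y ≢ z → y ≢ u → z ≢ u → ¬ D w y z u

  NoDAmong⇒Unrelated : p ≢ q → p ≢ r → p ≢ s → q ≢ r → q ≢ s → r ≢ s →
                       NoDAmong p q r s → Unrelated p q r s
  NoDAmong⇒Unrelated p≢q p≢r p≢s q≢r q≢s r≢s none =
    none _ _ _ _ p∈ q∈ r∈ s∈ p≢q p≢r p≢s q≢r q≢s r≢s ,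
    none _ _ _ _ p∈ r∈ q∈ s∈ p≢r p≢q p≢s (≢-sym q≢r) r≢s q≢s ,
    none _ _ _ _ p∈ s∈ q∈ r∈ p≢s p≢q p≢r (≢-sym q≢s) (≢-sym r≢s) q≢r
    where
    p∈ : ∀ {a b c d} → In4′ a b c d a
    p∈ = inj₁ refl
    q∈ : ∀ {a b c d} → In4′ a b c d b
    q∈ = inj₂ (inj₁ refl)
    r∈ : ∀ {a b c d} → In4′ a b c d c
    r∈ = inj₂ (inj₂ (inj₁ refl))
    s∈ : ∀ {a b c d} → In4′ a b c d d
    s∈ = inj₂ (inj₂ (inj₂ refl))

  In4-drop₁ : In4′ p q r s y → p ≢ y → In3 q r s y
  In4-drop₁ (inj₁ refl)  p≢y = contradiction refl p≢y
  In4-drop₁ (inj₂ y∈qrs) _   = y∈qrs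

  In4-drop₂ : In4′ p q r s y → q ≢ y → In3 p r s y
  In4-drop₂ (inj₁ y≡p)                _   = inj₁ y≡p
  In4-drop₂ (inj₂ (inj₁ refl))        q≢y = contradiction refl q≢y
  In4-drop₂ (inj₂ (inj₂ y∈rs))        _   = inj₂ y∈rs

  In4-drop₃ : In4′ p q r s y → r ≢ y → In3 p q s y
  In4-drop₃ (inj₁ y≡p)                _   = inj₁ y≡p
  In4-drop₃ (inj₂ (inj₁ y≡q))         _   = inj₂ (inj₁ y≡q)
  In4-drop₃ (inj₂ (inj₂ (inj₁ refl))) r≢y = contradiction refl r≢y
  In4-drop₃ (inj₂ (inj₂ (inj₂ y≡s)))  _   = inj₂ (inj₂ y≡s)

  In4-drop₄ : In4′ p q r s y → s ≢ y → In3 p q r y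
  In4-drop₄ (inj₁ y≡p)                _   = inj₁ y≡p
  In4-drop₄ (inj₂ (inj₁ y≡q))         _   = inj₂ (inj₁ y≡q)
  In4-drop₄ (inj₂ (inj₂ (inj₁ y≡r)))  _   = inj₂ (inj₂ y≡r)
  In4-drop₄ (inj₂ (inj₂ (inj₂ refl))) s≢y = contradiction refl s≢y

  In3-drop₁ : In3 q r s y → q ≢ y → In2 r s y
  In3-drop₁ (inj₁ refl)  q≢y = contradiction refl q≢y
  In3-drop₁ (inj₂ y∈rs)  _   = y∈rs

  In3-drop₂ : In3 q r s y → r ≢ y → In2 q s y
  In3-drop₂ (inj₁ y≡q)         _   = inj₁ y≡q
  In3-drop₂ (inj₂ (inj₁ refl)) r≢y = contradiction refl r≢y
  In3-drop₂ (inj₂ (inj₂ y≡s))  _   = inj₂ y≡s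

  In3-drop₃ : In3 q r s y → s ≢ y → In2 q r y
  In3-drop₃ (inj₁ y≡q)         _   = inj₁ y≡q
  In3-drop₃ (inj₂ (inj₁ y≡r))  _   = inj₂ y≡r
  In3-drop₃ (inj₂ (inj₂ refl)) s≢y = contradiction refl s≢y

  ¬D-pair : ¬ D p q r s → In2 r s z → In2 r s u → z ≢ u → ¬ D p q z u
  ¬D-pair _       (inj₁ refl) (inj₁ refl) z≢u = contradiction refl z≢u
  ¬D-pair ¬pq∣rs  (inj₁ refl) (inj₂ refl) _   = ¬pq∣rs
  ¬D-pair ¬pq∣rs  (inj₂ refl) (inj₁ refl) _   = ¬pq∣rs ∘ D-swapʳ
  ¬D-pair _       (inj₂ refl) (inj₂ refl) z≢u = contradiction refl z≢u

  Unrelated⇒¬D-head : Unrelated p q r s → In3 q r s y → In3 q r s z → In3 q r s u →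
                      y ≢ z → y ≢ u → z ≢ u → ¬ D p y z u
  Unrelated⇒¬D-head (¬pq∣rs , _ , _) (inj₁ refl) z∈ u∈ y≢z y≢u z≢u =
    ¬D-pair ¬pq∣rs (In3-drop₁ z∈ y≢z) (In3-drop₁ u∈ y≢u) z≢u
  Unrelated⇒¬D-head (_ , ¬pr∣qs , _) (inj₂ (inj₁ refl)) z∈ u∈ y≢z y≢u z≢u =
    ¬D-pair ¬pr∣qs (In3-drop₂ z∈ y≢z) (In3-drop₂ u∈ y≢u) z≢u
  Unrelated⇒¬D-head (_ , _ , ¬ps∣qr) (inj₂ (inj₂ refl)) z∈ u∈ y≢z y≢u z≢u =
    ¬D-pair ¬ps∣qr (In3-drop₃ z∈ y≢z) (In3-drop₃ u∈ y≢u) z≢u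

  Unrelated⇒NoDAmong : Unrelated p q r s → NoDAmong p q r s
  Unrelated⇒NoDAmong un w y z u (inj₁ refl) y∈ z∈ u∈ w≢y w≢z w≢u =
    Unrelated⇒¬D-head un (In4-drop₁ y∈ w≢y) (In4-drop₁ z∈ w≢z) (In4-drop₁ u∈ w≢u)
  Unrelated⇒NoDAmong un w y z u (inj₂ (inj₁ refl)) y∈ z∈ u∈ w≢y w≢z w≢u =
    Unrelated⇒¬D-head (Unrelated-swap₁₂ un) (In4-drop₂ y∈ w≢y) (In4-drop₂ z∈ w≢z) (In4-drop₂ u∈ w≢u)
  Unrelated⇒NoDAmong un w y z u (inj₂ (inj₂ (inj₁ refl))) y∈ z∈ u∈ w≢y w≢z w≢u =
    Unrelated⇒¬D-head (Unrelated-rotate₃ un) (In4-drop₃ y∈ w≢y) (In4-drop₃ z∈ w≢z) (In4-drop₃ u∈ w≢u)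
  Unrelated⇒NoDAmong un w y z u (inj₂ (inj₂ (inj₂ refl))) y∈ z∈ u∈ w≢y w≢z w≢u =
    Unrelated⇒¬D-head (Unrelated-rotate₄ un) (In4-drop₄ y∈ w≢y) (In4-drop₄ z∈ w≢z) (In4-drop₄ u∈ w≢u)

  SameSide : {J : Set} → (J → Ω) → Ω → Ω → Set
  SameSide b x y = ∀ m n → D x y (b m) (b n)

  Anchored : {I J : Set} → (I → Ω) → (J → Ω) → Ω → Set
  Anchored a b x = ∃₂ λ t r → ∀ n → D x (a t) (a r) (b n)

  Anchored⇒SameSide : {I J : Set} {a : I → Ω} {b : J → Ω} →
                      Anchored a b x → ∃ λ t → SameSide b x (a t)
  Anchored⇒SameSide (t , r , anchor) = t , λ m n → D-combine (anchor m) (anchor n)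

module SequenceProperties (M : DSet) (L : UnboundedLinearOrder) where
  open DSet M
  open UnboundedLinearOrder L
  open IsStrictTotalOrder isSTO using (irrefl) renaming (trans to <-trans)
  open DSetProperties M

  private variable
    i j k l : I
    p q x y : Ω

  <⇒≢ : i < j → i ≢ j
  <⇒≢ i<j refl = irrefl refl i<j

  Increasing-singleton : Increasing M L (i ∷ [])
  Increasing-singleton zero zero ()

  Increasing-∷ : ∀ {n} {f : Vector I (suc n)} → i < f zero → Increasing M L f →
                 Increasing M L (i ∷ f)
  Increasing-∷ i<f₀ f↑ zero    (suc zero)    _         = i<f₀
  Increasing-∷ i<f₀ f↑ zero    (suc (suc q)) _         = <-trans i<f₀ (f↑ zero (suc q) (s≤s z≤n))
  Increasing-∷ i<f₀ f↑ (suc p) (suc q)       (s≤s p<q) = f↑ p q p<q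

  Increasing₃ : i < j → j < k → Increasing M L (i ∷ j ∷ k ∷ [])
  Increasing₃ i<j j<k = Increasing-∷ i<j (Increasing-∷ j<k Increasing-singleton)

  Increasing₄ : i < j → j < k → k < l → Increasing M L (i ∷ j ∷ k ∷ l ∷ [])
  Increasing₄ i<j j<k k<l = Increasing-∷ i<j (Increasing₃ j<k k<l)

  module Sectors {E : Rel Ω 0ℓ} (splitting : IsSplitting M L E) where
    open IsSplitting splitting public
    open IsEquivalence isEquiv public renaming (sym to E-sym; trans to E-trans)

    D⇒¬¬sameSector : ¬ E x p → ¬ E x q → ¬ E p q → D x y p q → ¬ ¬ E x y
    D⇒¬¬sameSector {x} {p} {q} {y} x≁p x≁q p≁q xy∣pq x≁y =
      ¬¬-excluded-middle λ where
        (yes y~p) → D2 (condI y p x q y~p y≁x (p≁q ∘ E-trans (E-sym y~p))) (D-swapˡ xy∣pq)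
        (no y≁p)  → ¬¬-excluded-middle λ where
          (yes y~q) → D2 (condI y q x p y~q y≁x y≁p) (D-swapʳ (D-swapˡ xy∣pq))
          (no y≁q)  → condII x y p q x≁y x≁p x≁q y≁p y≁q p≁q xy∣pq
      where
      y≁x : ¬ E y x
      y≁x = x≁y ∘ E-sym

    module Petals {t : Seq M L} (distinct : PairwiseDistinct M L t)
                  (separated : ∀ i j → E (t i) (t j) → t i ≡ t j) where

      sectors-differ : i ≢ j → ¬ E (t i) (t j)
      sectors-differ i≢j = distinct _ _ i≢j ∘ separated _ _

      leaves-sector : E x (t i) → i ≢ j → ¬ E x (t j)
      leaves-sector x~tᵢ i≢j x~tⱼ = sectors-differ i≢j (E-trans (E-sym x~tᵢ) x~tⱼ)

  module _ {t : Seq M L} where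

    Hull-index : Hull M L t x → I
    Hull-index (inj₁ (_ , _ , _ , _ , i , _))                    = i
    Hull-index (inj₂ (lift (_ , inj₁ (i , _))))                  = i
    Hull-index (inj₂ (lift (_ , inj₂ (inj₁ (i , _)))))           = i
    Hull-index (inj₂ (lift (_ , inj₂ (inj₂ (inj₁ (i , _))))))    = i
    Hull-index (inj₂ (lift (_ , inj₂ (inj₂ (inj₂ (i , _))))))    = i

    H₂⇒Unrelated : PairwiseDistinct M L t → (∀ i → t i ≢ x) → i < j → j < k →
                   NoDAmong (t i) (t j) (t k) x → Unrelated (t i) (t j) (t k) x
    H₂⇒Unrelated distinct x∉t i<j j<k =
      NoDAmong⇒Unrelated (apart i<j) (apart (<-trans i<j j<k)) (x∉t _) (apart j<k) (x∉t _) (x∉t _)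
      where
      apart : ∀ {i j} → i < j → t i ≢ t j
      apart = distinct _ _ ∘ <⇒≢

    PetalHull-sameSide : Petaled M L t → SameSide t x y → PetalHull M L t x → ¬ ¬ PetalHull M L t y
    PetalHull-sameSide (distinct , _) same (E , (splitting , node) , separated , j , x~tⱼ) =
      let open Sectors splitting
          open Petals distinct separated
          (k , j<k) = noGreatest j
          (l , k<l) = noGreatest k
      in ¬¬-map (λ x~y → E , (splitting , node) , separated , j , E-trans (E-sym x~y) x~tⱼ)
                (D⇒¬¬sameSector (leaves-sector x~tⱼ (<⇒≢ j<k))
                                (leaves-sector x~tⱼ (<⇒≢ (<-trans j<k k<l)))
                                (sectors-differ (<⇒≢ k<l)) (same k l))

    H₁-sameSide : SameSide t x y → H₁ M L t x → H₁ M L t y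
    H₁-sameSide {y = y} same (i , j , k , i<j , j<k , ik∣jx) with D3 ik∣jx y
    ... | inj₂ ik∣jy = i , j , k , i<j , j<k , ik∣jy
    ... | inj₁ yk∣jx = contradiction (D-swapʳ (D-swapˡ (same j k))) (D2 (D-swapʳ yk∣jx))

    H₂-sameSide : PairwiseDistinct M L t → (∀ i → t i ≢ x) → SameSide t x y →
                  H₂ M L t x → H₂ M L t y
    H₂-sameSide {x = x} {y = y} distinct x∉t same (i , j , k , i<j , j<k , none) =
      i , j , k , i<j , j<k , Unrelated⇒NoDAmong (¬ij∣ky , ¬ik∣jy , ¬iy∣jk)
      where
      unrelated : Unrelated (t i) (t j) (t k) x
      unrelated = H₂⇒Unrelated distinct x∉t i<j j<k none
      ¬ij∣ky : ¬ D (t i) (t j) (t k) y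
      ¬ij∣ky ij∣ky with D3 (D-swapˡ (D-swapPairs ij∣ky)) x
      ... | inj₁ xk∣ij = proj₁ unrelated (D-swapʳ (D-swapPairs xk∣ij))
      ... | inj₂ yk∣ix = D2 (D-swapʳ yk∣ix) (D-swapʳ (D-swapˡ (same i k)))
      ¬ik∣jy : ¬ D (t i) (t k) (t j) y
      ¬ik∣jy ik∣jy with D3 (D-swapˡ (D-swapPairs ik∣jy)) x
      ... | inj₁ xj∣ik = proj₁ (proj₂ unrelated) (D-swapʳ (D-swapPairs xj∣ik))
      ... | inj₂ yj∣ix = D2 (D-swapʳ yj∣ix) (D-swapʳ (D-swapˡ (same i j)))
      ¬iy∣jk : ¬ D (t i) y (t j) (t k)
      ¬iy∣jk iy∣jk with D3 (D-swapˡ iy∣jk) x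
      ... | inj₁ xi∣jk = proj₂ (proj₂ unrelated) (D-swapˡ xi∣jk)
      ... | inj₂ yi∣jx = D2 (D-swapʳ yi∣jx) (D-swapˡ (same i j))

    H₃-sameSide : SameSide t x y → H₃ M L t x → H₃ M L t y
    H₃-sameSide {y = y} same (i , j , k , l , i<j , j<k , k<l , ix∣kl , ij∣xl) =
      i , j , k , l , i<j , j<k , k<l , iy∣kl , ij∣yl
      where
      iy∣kl : D (t i) y (t k) (t l)
      iy∣kl with D3 (D-swapˡ ix∣kl) y
      ... | inj₁ yi∣kl = D-swapˡ yi∣kl
      ... | inj₂ xi∣ky = contradiction (same i k) (D2 (D-swapʳ xi∣ky))
      ij∣yl : D (t i) (t j) y (t l)
      ij∣yl with D3 (D-swapPairs ij∣xl) y
      ... | inj₁ yl∣ij = D-swapPairs yl∣ij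
      ... | inj₂ xl∣iy = contradiction (same l i) (D2 (D-swapʳ xl∣iy))

    Hull-sameSide : (∀ i → t i ≢ x) → SameSide t x y → Hull M L t x → ¬ ¬ Hull M L t y
    Hull-sameSide x∉t same (inj₁ (lift petaled , x∈H)) =
      ¬¬-map (λ y∈H → inj₁ (lift petaled , y∈H)) (PetalHull-sameSide petaled same x∈H)
    Hull-sameSide {x = x} {y = y} x∉t same (inj₂ (lift (monotonic , x∈H))) ¬y∈H =
      ¬y∈H (inj₂ (lift (monotonic , monoHull x∈H)))
      where
      monoHull : MonoHull M L t x → MonoHull M L t y
      monoHull (inj₁ (i , tᵢ≡x))          = contradiction tᵢ≡x (x∉t i)
      monoHull (inj₂ (inj₁ x∈H₁))         = inj₂ (inj₁ (H₁-sameSide same x∈H₁))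
      monoHull (inj₂ (inj₂ (inj₁ x∈H₂)))  = inj₂ (inj₂ (inj₁ (H₂-sameSide (proj₁ monotonic) x∉t same x∈H₂)))
      monoHull (inj₂ (inj₂ (inj₂ x∈H₃)))  = inj₂ (inj₂ (inj₂ (H₃-sameSide same x∈H₃)))

  LiesAfter : Seq M L → {J : Set} → (J → Ω) → Set
  LiesAfter a b = ∀ {i j k} → i < j → j < k → ∀ n → D (a i) (a j) (a k) (b n)

  LiesBefore : Seq M L → {J : Set} → (J → Ω) → Set
  LiesBefore a b = ∀ {i j k} → i < j → j < k → ∀ n → D (a i) (b n) (a j) (a k)

  module _ {a : Seq M L} {J : Set} {b : J → Ω} where

    PetalHull-anchored : Petaled M L a → (∀ n → ¬ PetalHull M L a (b n)) →
                         PetalHull M L a x → Anchored a b x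
    PetalHull-anchored {x} (distinct , _) b∉H (E , (splitting , node) , separated , i , x~aᵢ) =
      let open Sectors splitting
          open Petals distinct separated
          (r , i<r) = noGreatest i
          x≁bₙ : ∀ n → ¬ E x (b n)
          x≁bₙ n x~bₙ = b∉H n (E , (splitting , node) , separated , i , E-trans (E-sym x~bₙ) x~aᵢ)
      in i , r , λ n → condI x (a i) (a r) (b n) x~aᵢ (leaves-sector x~aᵢ (<⇒≢ i<r)) (x≁bₙ n)

    H₁-anchored : H₁ M L a x → LiesAfter a b ⊎ LiesBefore a b → Anchored a b x
    H₁-anchored {x} (i , j , k , i<j , j<k , ik∣jx) (inj₁ after) = j , k , λ n → anchor n (D3 ik∣jx (b n))
      where
      anchor : ∀ n → D (b n) (a k) (a j) x ⊎ D (a i) (a k) (a j) (b n) → D x (a j) (a k) (b n)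
      anchor n (inj₁ bk∣jx) = D-swapʳ (D-swapˡ (D-swapPairs bk∣jx))
      anchor n (inj₂ ik∣jb) = contradiction ik∣jb (D2 (after i<j j<k n))
    H₁-anchored {x} (i , j , k , i<j , j<k , ik∣jx) (inj₂ before) = j , i , λ n → anchor n (D3 (D-swapˡ ik∣jx) (b n))
      where
      anchor : ∀ n → D (b n) (a i) (a j) x ⊎ D (a k) (a i) (a j) (b n) → D x (a j) (a i) (b n)
      anchor n (inj₁ bi∣jx) = D-swapʳ (D-swapˡ (D-swapPairs bi∣jx))
      anchor n (inj₂ ki∣jb) = contradiction (D-swapʳ (D-swapˡ ki∣jb)) (D2 (D-swapʳ (before i<j j<k n)))

    H₂-anchored : PairwiseDistinct M L a → (∀ i → a i ≢ x) →
                  H₂ M L a x → LiesAfter a b ⊎ LiesBefore a b → Anchored a b x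
    H₂-anchored {x} distinct x∉a (i , j , k , i<j , j<k , none) (inj₁ after) =
      j , k , λ n → anchor (D3 (after i<j j<k n) x)
      where
      anchor : ∀ {n} → D x (a j) (a k) (b n) ⊎ D (a i) (a j) (a k) x → D x (a j) (a k) (b n)
      anchor (inj₁ xj∣kb) = xj∣kb
      anchor (inj₂ ij∣kx) = contradiction ij∣kx (proj₁ (H₂⇒Unrelated distinct x∉a i<j j<k none))
    H₂-anchored {x} distinct x∉a (i , j , k , i<j , j<k , none) (inj₂ before) =
      j , i , λ n → anchor (D3 (D-swapˡ (D-swapPairs (before i<j j<k n))) x)
      where
      anchor : ∀ {n} → D x (a j) (a i) (b n) ⊎ D (a k) (a j) (a i) x → D x (a j) (a i) (b n)
      anchor (inj₁ xj∣ib) = xj∣ib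
      anchor (inj₂ kj∣ix) = contradiction (D-swapʳ (D-swapPairs kj∣ix))
                                          (proj₂ (proj₂ (H₂⇒Unrelated distinct x∉a i<j j<k none)))

    H₃-anchored : H₃ M L a x → LiesAfter a b ⊎ LiesBefore a b → Anchored a b x
    H₃-anchored {x} (i , j , k , l , i<j , j<k , k<l , ix∣kl , ij∣xl) (inj₁ after) =
      k , l , λ n → anchor (D3 (after (<-trans i<j j<k) k<l n) x)
      where
      anchor : ∀ {n} → D x (a k) (a l) (b n) ⊎ D (a i) (a k) (a l) x → D x (a k) (a l) (b n)
      anchor (inj₁ xk∣lb) = xk∣lb
      anchor (inj₂ ik∣lx) = contradiction (D-swapʳ ik∣lx) (D2 ix∣kl)
    H₃-anchored {x} (i , j , k , l , i<j , j<k , k<l , ix∣kl , ij∣xl) (inj₂ before) =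
      j , i , λ n → anchor (D3 (D-swapˡ (D-swapPairs (before i<j (<-trans j<k k<l) n))) x)
      where
      anchor : ∀ {n} → D x (a j) (a i) (b n) ⊎ D (a l) (a j) (a i) x → D x (a j) (a i) (b n)
      anchor (inj₁ xj∣ib) = xj∣ib
      anchor (inj₂ lj∣ix) = contradiction (D-swapˡ lj∣ix) (D2 (D-swapʳ (D-swapˡ ij∣xl)))

    MonoHull-anchored : Monotonic M L a → (∀ i → a i ≢ x) →
                        MonoHull M L a x → LiesAfter a b ⊎ LiesBefore a b → Anchored a b x
    MonoHull-anchored _ x∉a (inj₁ (i , aᵢ≡x))                = contradiction aᵢ≡x (x∉a i)
    MonoHull-anchored _ _   (inj₂ (inj₁ x∈H₁))               = H₁-anchored x∈H₁
    MonoHull-anchored (distinct , _) x∉a (inj₂ (inj₂ (inj₁ x∈H₂))) = H₂-anchored distinct x∉a x∈H₂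
    MonoHull-anchored _ _   (inj₂ (inj₂ (inj₂ x∈H₃)))        = H₃-anchored x∈H₃

module IndiscernibleProperties (M : DSet) (L : UnboundedLinearOrder) {m : ℕ}
  (s : TupleSeq M L m) (c : Fin m) (A : DSet.Ω M → Set) (indiscernible : IndiscernibleOver M L A s)
  where
  open DSet M
  open UnboundedLinearOrder L
  open IsStrictTotalOrder isSTO using () renaming (trans to <-trans)
  open DSetProperties M
  open SequenceProperties M L

  private variable
    n : ℕ
    i : I
    y : Ω

  t : Seq M L
  t i = s i c

  Slot : ℕ → Set
  Slot n = (Fin n × Fin m) ⊎ Σ Ω A

  entry : Fin n → Slot n
  entry p = inj₁ (p , c)

  param : A y → Slot n
  param {y} y∈A = inj₂ (y , y∈A)

  D-atom : Formula P 4
  D-atom = DF (# 0) (# 1) (# 2) (# 3)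

  transferD : (w x y z : Slot n) {f g : Vector I n} → Increasing M L f → Increasing M L g →
              Sat M D-atom (instantiate M L A s f (w ∷ x ∷ y ∷ z ∷ [])) →
              Sat M D-atom (instantiate M L A s g (w ∷ x ∷ y ∷ z ∷ []))
  transferD w x y z f↑ g↑ = Equivalence.to (indiscernible D-atom (w ∷ x ∷ y ∷ z ∷ []) _ _ f↑ g↑)

  param∉range : PairwiseDistinct M L t → A y → t i ≢ y
  param∉range {y} {i} distinct y∈A tᵢ≡y =
    let (j , i<j) = noGreatest i
        tⱼ≡y : t j ≡ y
        tⱼ≡y = Equivalence.to
                 (indiscernible (eqF (# 0) (# 1)) (entry (# 0) ∷ param y∈A ∷ []) _ _
                                Increasing-singleton Increasing-singleton)
                 tᵢ≡y
    in distinct i j (<⇒≢ i<j) (trans tᵢ≡y (sym tⱼ≡y))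

  param∉PetalHull : Petaled M L t → A y → ¬ PetalHull M L t y
  param∉PetalHull {y} (distinct , _) y∈A (E , (splitting , _) , separated , i , y~tᵢ) =
    let open Sectors splitting
        open Petals distinct separated
        (j , i<j) = noGreatest i
        (k , j<k) = noGreatest j
        (l , k<l) = noGreatest k
        y≁ : ∀ {j} → i < j → ¬ E y (t j)
        y≁ i<j = leaves-sector y~tᵢ (<⇒≢ i<j)
        yi∣jk : D y (t i) (t j) (t k)
        yi∣jk = condI y (t i) (t j) (t k) y~tᵢ (y≁ i<j) (y≁ (<-trans i<j j<k))
        yj∣kl : D y (t j) (t k) (t l)
        yj∣kl = transferD (param y∈A) (entry (# 0)) (entry (# 1)) (entry (# 2))
                          (Increasing₃ i<j j<k) (Increasing₃ j<k k<l) yi∣jk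
    in condII y (t j) (t k) (t l) (y≁ i<j) (y≁ (<-trans i<j j<k)) (y≁ (<-trans (<-trans i<j j<k) k<l))
              (sectors-differ (<⇒≢ j<k)) (sectors-differ (<⇒≢ (<-trans j<k k<l)))
              (sectors-differ (<⇒≢ k<l)) yj∣kl

  param∉H₁ : Monotonic M L t → A y → ¬ H₁ M L t y
  param∉H₁ {y} (_ , mono) y∈A (i , j , k , i<j , j<k , ik∣jy) =
    let (l , k<l) = noGreatest k
        jl∣ky : D (t j) (t l) (t k) y
        jl∣ky = transferD (entry (# 0)) (entry (# 2)) (entry (# 1)) (param y∈A)
                          (Increasing₃ i<j j<k) (Increasing₃ j<k k<l) ik∣jy
    in [ (λ yj∣kl → D2 yj∣kl (D-swapˡ (D-swapPairs jl∣ky))) , (λ ij∣ky → D2 ij∣ky ik∣jy) ]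
       (D3 (mono i j k l i<j j<k k<l) y)

  param∉H₂ : Monotonic M L t → A y → ¬ H₂ M L t y
  param∉H₂ {y} (distinct , mono) y∈A (i , j , k , i<j , j<k , none) =
    let (l , k<l) = noGreatest k
        (¬ij∣ky , _ , ¬iy∣jk) = H₂⇒Unrelated distinct (λ _ → param∉range distinct y∈A) i<j j<k none
        iy∣jk : D y (t j) (t k) (t l) → D (t i) y (t j) (t k)
        iy∣jk yj∣kl = transferD (entry (# 0)) (param y∈A) (entry (# 1)) (entry (# 2))
                                (Increasing₃ j<k k<l) (Increasing₃ i<j j<k) (D-swapˡ yj∣kl)
    in [ ¬iy∣jk ∘ iy∣jk , ¬ij∣ky ] (D3 (mono i j k l i<j j<k k<l) y)

  param∉H₃ : Monotonic M L t → A y → ¬ H₃ M L t y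
  param∉H₃ {y} (_ , mono) y∈A (i , j , k , l , i<j , j<k , k<l , iy∣kl , ij∣yl) =
    let (n , l<n) = noGreatest l
        ik∣yn : D (t i) (t k) y (t n)
        ik∣yn = transferD (entry (# 0)) (entry (# 1)) (param y∈A) (entry (# 3))
                          (Increasing₄ i<j j<k k<l) (Increasing₄ (<-trans i<j j<k) k<l l<n) ij∣yl
        iy∣kn : D (t i) y (t k) (t n)
        iy∣kn = transferD (entry (# 0)) (param y∈A) (entry (# 2)) (entry (# 3))
                          (Increasing₄ i<j j<k k<l) (Increasing₄ i<j j<k (<-trans k<l l<n)) iy∣kl
    in inconsistent ik∣yn iy∣kn (mono i k l n (<-trans i<j j<k) k<l l<n)
    where
    inconsistent : ∀ {n} → D (t i) (t k) y (t n) → D (t i) y (t k) (t n) → D (t i) (t k) (t l) (t n) → ⊥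
    inconsistent ik∣yn iy∣kn ik∣ln with D3 ik∣yn (t l)
    ... | inj₂ ik∣yl = D2 iy∣kl ik∣yl
    ... | inj₁ lk∣yn with D3 (D-swapʳ (D-swapPairs lk∣yn)) (t i)
    ...   | inj₁ in∣kl = D2 (D-swapʳ ik∣ln) in∣kl
    ...   | inj₂ yn∣ki = D2 (D-swapʳ yn∣ki) (D-swapʳ (D-swapˡ iy∣kn))

  param∉Hull : A y → ¬ Hull M L t y
  param∉Hull y∈A (inj₁ (lift petaled , y∈H))                    = param∉PetalHull petaled y∈A y∈H
  param∉Hull y∈A (inj₂ (lift (mono , inj₁ (i , tᵢ≡y))))          = param∉range (proj₁ mono) y∈A tᵢ≡y
  param∉Hull y∈A (inj₂ (lift (mono , inj₂ (inj₁ y∈H₁))))         = param∉H₁ mono y∈A y∈H₁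
  param∉Hull y∈A (inj₂ (lift (mono , inj₂ (inj₂ (inj₁ y∈H₂)))))  = param∉H₂ mono y∈A y∈H₂
  param∉Hull y∈A (inj₂ (lift (mono , inj₂ (inj₂ (inj₂ y∈H₃)))))  = param∉H₃ mono y∈A y∈H₃

module MutuallyIndiscernible (M : DSet) (L₁ L₂ : UnboundedLinearOrder) {m₁ m₂ : ℕ}
  (s₁ : TupleSeq M L₁ m₁) (s₂ : TupleSeq M L₂ m₂)
  (indiscernible₁₂ : IndiscernibleOver M L₁ (ElemsOf M L₂ s₂) s₁)
  (indiscernible₂₁ : IndiscernibleOver M L₂ (ElemsOf M L₁ s₁) s₂)
  (c₁ : Fin m₁) (c₂ : Fin m₂)
  where
  open DSet M
  open UnboundedLinearOrder L₁ using (noGreatest) renaming (I to I₁; _<_ to _<₁_)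
  open UnboundedLinearOrder L₂ using () renaming (I to I₂)
  open DSetProperties M
  open SequenceProperties M L₁ using (LiesAfter; LiesBefore; Increasing₃)
  module Seq₁ = SequenceProperties M L₁
  module Seq₂ = SequenceProperties M L₂
  module Ind₁ = IndiscernibleProperties M L₁ s₁ c₁ (ElemsOf M L₂ s₂) indiscernible₁₂
  module Ind₂ = IndiscernibleProperties M L₂ s₂ c₂ (ElemsOf M L₁ s₁) indiscernible₂₁

  private variable
    i j k : I₁
    n₀ : I₂
    x : Ω

  a : Seq M L₁
  a = Ind₁.t

  b : Seq M L₂
  b = Ind₂.t

  b∉Hull-a : ∀ n → ¬ Hull M L₁ a (b n)
  b∉Hull-a n = Ind₁.param∉Hull (n , c₂ , refl)

  a∉Hull-b : ∀ i → ¬ Hull M L₂ b (a i)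
  a∉Hull-b i = Ind₂.param∉Hull (i , c₁ , refl)

  liesAfter-from-one : i <₁ j → j <₁ k → D (a i) (a j) (a k) (b n₀) → LiesAfter a b
  liesAfter-from-one {i} {j} {k} {n₀} i<j j<k ij∣kb {i′} {j′} {k′} i′<j′ j′<k′ n =
    Ind₂.transferD (Ind₂.param (i′ , c₁ , refl)) (Ind₂.param (j′ , c₁ , refl))
                   (Ind₂.param (k′ , c₁ , refl)) (Ind₂.entry (# 0))
                   Seq₂.Increasing-singleton Seq₂.Increasing-singleton
      (Ind₁.transferD (Ind₁.entry (# 0)) (Ind₁.entry (# 1)) (Ind₁.entry (# 2))
                      (Ind₁.param (n₀ , c₂ , refl))
                      (Increasing₃ i<j j<k) (Increasing₃ i′<j′ j′<k′) ij∣kb)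

  liesBefore-from-one : i <₁ j → j <₁ k → D (a i) (b n₀) (a j) (a k) → LiesBefore a b
  liesBefore-from-one {i} {j} {k} {n₀} i<j j<k ib∣jk {i′} {j′} {k′} i′<j′ j′<k′ n =
    Ind₂.transferD (Ind₂.param (i′ , c₁ , refl)) (Ind₂.entry (# 0))
                   (Ind₂.param (j′ , c₁ , refl)) (Ind₂.param (k′ , c₁ , refl))
                   Seq₂.Increasing-singleton Seq₂.Increasing-singleton
      (Ind₁.transferD (Ind₁.entry (# 0)) (Ind₁.param (n₀ , c₂ , refl))
                      (Ind₁.entry (# 1)) (Ind₁.entry (# 2))
                      (Increasing₃ i<j j<k) (Increasing₃ i′<j′ j′<k′) ib∣jk)

  -- otherwise b n₀ would lie in H₁(a) or H₂(a)
  liesAfter-or-liesBefore : Monotonic M L₁ a → I₁ → I₂ → ¬ ¬ (LiesAfter a b ⊎ LiesBefore a b)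
  liesAfter-or-liesBefore monotonic i n₀ ¬either =
    let (j , i<j) = noGreatest i
        (k , j<k) = noGreatest j
        b∉H : MonoHull M L₁ a (b n₀) → ⊥
        b∉H b∈H = b∉Hull-a n₀ (inj₂ (lift (monotonic , b∈H)))
    in ¬¬-excluded-middle λ where
         (yes ij∣kb) → ¬either (inj₁ (liesAfter-from-one i<j j<k ij∣kb))
         (no ¬ij∣kb) → ¬¬-excluded-middle λ where
           (yes ib∣jk) → ¬either (inj₂ (liesBefore-from-one i<j j<k ib∣jk))
           (no ¬ib∣jk) → b∉H (inj₂ (inj₂ (inj₁ (i , j , k , i<j , j<k , Unrelated⇒NoDAmong
                           (¬ij∣kb , (λ ik∣jb → b∉H (inj₂ (inj₁ (i , j , k , i<j , j<k , ik∣jb)))) , ¬ib∣jk)))))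

  Hull-anchored : (∀ i → a i ≢ x) → I₂ → Hull M L₁ a x → ¬ ¬ Anchored a b x
  Hull-anchored x∉a n₀ (inj₁ (lift petaled , x∈H)) ¬anchored =
    ¬anchored (Seq₁.PetalHull-anchored petaled (λ n b∈H → b∉Hull-a n (inj₁ (lift petaled , b∈H))) x∈H)
  Hull-anchored x∉a n₀ x∈Hull@(inj₂ (lift (monotonic , x∈H))) =
    ¬¬-map (Seq₁.MonoHull-anchored monotonic x∉a x∈H)
           (liesAfter-or-liesBefore monotonic (Seq₁.Hull-index x∈Hull) n₀)

  Hull-disjoint : Hull M L₁ a x → Hull M L₂ b x → ⊥
  Hull-disjoint {x} x∈Hull-a x∈Hull-b =
    Hull-anchored x∉a (Seq₂.Hull-index x∈Hull-b) x∈Hull-a λ anchored →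
      let (t , same) = Anchored⇒SameSide anchored
      in Seq₂.Hull-sameSide x∉b same x∈Hull-b (a∉Hull-b t)
    where
    x∉a : ∀ i → a i ≢ x
    x∉a i aᵢ≡x = Ind₂.param∉Hull (i , c₁ , aᵢ≡x) x∈Hull-b
    x∉b : ∀ n → b n ≢ x
    x∉b n bₙ≡x = Ind₁.param∉Hull (n , c₂ , bₙ≡x) x∈Hull-a

mainTheorem19 : (M : DSet) (L₁ L₂ : UnboundedLinearOrder) {m₁ m₂ : ℕ}
    (s₁ : TupleSeq M L₁ m₁) (s₂ : TupleSeq M L₂ m₂) →
    Indiscernible M L₁ s₁ → Indiscernible M L₂ s₂ →
    IndiscernibleOver M L₁ (ElemsOf M L₂ s₂) s₁ →
    IndiscernibleOver M L₂ (ElemsOf M L₁ s₁) s₂ →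
    ∀ x → HullT M L₁ s₁ x → HullT M L₂ s₂ x → ⊥
mainTheorem19 M L₁ L₂ s₁ s₂ _ _ indiscernible₁₂ indiscernible₂₁ x (c₁ , x∈H₁) (c₂ , x∈H₂) =
  MutuallyIndiscernible.Hull-disjoint M L₁ L₂ s₁ s₂ indiscernible₁₂ indiscernible₂₁ c₁ c₂ x∈H₁ x∈H₂
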